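{- Let $\Gamma$ be a connected graph with vertices $x,x_1,\dots,x_{n-1}$ ($n\ge 2$) such that $x_1x_2\cdots x_{n-1}$ is an induced path, and let $v\in\mathbb{F}_2^{n-1}$ have $i$-th entry $1$ iff $x$ is adjacent to $x_i$. Let $N\in M_{n-1}(\mathbb{F}_2)$ be a tridiagonal matrix with all subdiagonal and superdiagonal entries equal to $1$ and arbitrary diagonal, and for $c\in\mathbb{F}_2$ let $N(c)=\begin{pmatrix} c & v^\top\\ v & N\end{pmatrix}\in M_n(\mathbb{F}_2)$. Then: (1) if $\mathrm{rank}(N)=n-1$, one of $N(0),N(1)$ has rank $n-1$ and the other has rank $n$; (2) if $\mathrm{rank}(N)=n-2$ and $v^\top$ is not in the row space of $N$, then both $N(0)$ and $N(1)$ have rank $n$; (3) if $\mathrm{rank}(N)=n-2$ and $v^\top$ is in the row space of $N$, then one of $N(0),N(1)$ has rank $n-2$ and the other has rank $n-1$.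
   Context: All matrices are over $\mathbb{F}_2$. The matrices $N(0),N(1)$ are exactly the two symmetric matrices representing $\Gamma$ in the vertex order $x,x_1,\dots,x_{n-1}$ whose lower-right $(n-1)\times(n-1)$ block is $N$. -}

module Defs where

open import Data.Bool using (Bool; true; false; _xor_; _∧_)
open import Data.Nat using (ℕ; zero; suc)
open import Data.Fin using (Fin; zero; suc; toℕ)
open import Data.Product using (Σ; _×_; ∃)
open import Data.Sum using (_⊎_)
open import Relation.Nullary using (¬_)
open import Relation.Binary.PropositionalEquality using (_≡_)
open import Function using (_∘_)

-- Matrices over F₂ = Bool (with xor as addition, ∧ as multiplication),
-- as functions  Fin a → Fin b → Bool  (rows × columns).
Mat : ℕ → ℕ → Set
Mat a b = Fin a → Fin b → Bool

sumRows : ∀ {k m} → Mat k m → Fin m → Bool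
sumRows {zero}  f j = false
sumRows {suc k} f j = f zero j xor sumRows (f ∘ suc) j

combo : ∀ {k m} → (Fin k → Bool) → Mat k m → Fin m → Bool
combo c rows = sumRows (λ i j → c i ∧ rows i j)

LinIndep : ∀ {k m} → Mat k m → Set
LinIndep {k} rows =
  ∀ (c : Fin k → Bool) → (∀ j → combo c rows j ≡ false) → ∀ i → c i ≡ false

HasRank : ∀ {a b} → Mat a b → ℕ → Set
HasRank {a} M r =
  (Σ (Fin r → Fin a) λ f → LinIndep (M ∘ f)) ×
  (∀ (f : Fin (suc r) → Fin a) → ¬ LinIndep (M ∘ f))

InRowSpace : ∀ {a b} → Mat a b → (Fin b → Bool) → Set
InRowSpace {a} M w = Σ (Fin a → Bool) λ c → ∀ j → combo c M j ≡ w j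

bordered : ∀ {m} → Bool → (Fin m → Bool) → Mat m m → Mat (suc m) (suc m)
bordered c v N zero    zero    = c
bordered c v N zero    (suc j) = v j
bordered c v N (suc i) zero    = v i
bordered c v N (suc i) (suc j) = N i j

Adjacent : ∀ {m} → Fin m → Fin m → Set
Adjacent i j = toℕ j ≡ suc (toℕ i) ⊎ toℕ i ≡ suc (toℕ j)

IsTridiagOnes : ∀ {m} → Mat m m → Set
IsTridiagOnes {m} N =
  (∀ i j → Adjacent i j → N i j ≡ true) ×
  (∀ i j → ¬ (i ≡ j) → ¬ Adjacent i j → N i j ≡ false)

IsSimpleGraph : ∀ {n} → (Fin n → Fin n → Bool) → Set
IsSimpleGraph {n} adj = (∀ a b → adj a b ≡ adj b a) × (∀ a → adj a a ≡ false)

data Reach {n} (adj : Fin n → Fin n → Bool) : Fin n → Fin n → Set where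
  here : ∀ {a} → Reach adj a a
  step : ∀ {a b c} → adj a b ≡ true → Reach adj b c → Reach adj a c

Connected : ∀ {n} → (Fin n → Fin n → Bool) → Set
Connected {n} adj = ∀ a b → Reach adj a b

-- Vertices suc 0, …, suc (m-1) (i.e. x₁ … x_{m}) form an induced path
-- x₁ x₂ ⋯ x_m in that order.
InducedPath : ∀ {m} → (Fin (suc m) → Fin (suc m) → Bool) → Set
InducedPath {m} adj =
  (∀ (i j : Fin m) → Adjacent i j → adj (suc i) (suc j) ≡ true) ×
  (∀ (i j : Fin m) → ¬ Adjacent i j → adj (suc i) (suc j) ≡ false)

-- Pick rows f of N forming a basis of its row space. If v = Σ w_l N_{f l}, then by
-- symmetry each lower row (v_a, N_a) of the bordered matrix is the same combination
-- of the rows (v_{f l}, N_{f l}) as N_a is of the N_{f l}, and the top row (c, vᵀ)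
-- agrees with Σ w_l (v_{f l}, N_{f l}) except possibly in the corner, where the latter
-- has Σ w_l v_{f l}. Hence the rank is r if c equals that value and r + 1 otherwise.
-- If N has corank one and v is not in its row space, then v together with the basis
-- rows spans F₂ⁿ⁻¹; a left null vector of the bordered matrix is orthogonal to all of
-- them, hence zero, and the bordered matrix is nonsingular.

module Submission where

open import Defs
open import Algebra.Bundles using (CommutativeRing)
open import Data.Bool using (Bool; true; false; _xor_; _∧_; not)
open import Data.Bool.Properties
  using (xor-∧-commutativeRing; ∧-comm; ∧-assoc; ∧-zeroʳ; ∧-identityʳ; ∧-distribˡ-xor; ∧-distribʳ-xor;
         xor-assoc; xor-comm; xor-same; xor-identityʳ; ¬-not; not-¬)
  renaming (_≟_ to _≟ᵇ_)
open import Data.Fin using (Fin; zero; suc; toℕ; punchIn)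
open import Data.Fin.Properties using (any?; all?) renaming (_≟_ to _≟ᶠ_)
open import Data.Nat using (ℕ; zero; suc; _≤_; z≤n; s≤s)
open import Data.Nat.Properties using (1+n≰n) renaming (_≟_ to _≟ⁿ_)
open import Data.Product using (∃; _×_; _,_; proj₁; proj₂)
open import Data.Sum using (_⊎_; inj₁; inj₂; swap)
open import Data.Empty using (⊥-elim)
open import Data.Vec.Functional using (_∷_)
open import Function using (_∘_; id)
open import Relation.Nullary using (¬_; Dec; yes; no)
open import Relation.Nullary.Decidable using (_⊎-dec_)
open import Relation.Binary.PropositionalEquality

open CommutativeRing xor-∧-commutativeRing using (semiring)
open import Algebra.Properties.Semiring.Sum semiring
  using (sum; sum-cong-≗; sum-replicate-zero; sum-remove; ∑-distrib-+; ∑-comm;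
         *-distribˡ-sum; *-distribʳ-sum)

Vec₂ : ℕ → Set
Vec₂ m = Fin m → Bool

infix 7 _·_
_·_ : ∀ {k} → Vec₂ k → Vec₂ k → Bool
x · y = sum (λ i → x i ∧ y i)

xor≡false⇒≡ : ∀ a b → a xor b ≡ false → a ≡ b
xor≡false⇒≡ false b e = sym e
xor≡false⇒≡ true true e = refl

xor-cancelˡ : ∀ a b → a xor (a xor b) ≡ b
xor-cancelˡ a b = trans (sym (xor-assoc a a b)) (cong (_xor b) (xor-same a))

sum-zero : ∀ {k} {g : Vec₂ k} → (∀ i → g i ≡ false) → sum g ≡ false
sum-zero {k} g≡0 = trans (sum-cong-≗ g≡0) (sum-replicate-zero k)

·-comm : ∀ {k} (x y : Vec₂ k) → x · y ≡ y · x
·-comm x y = sum-cong-≗ (λ i → ∧-comm (x i) (y i))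

·-distribʳ-xor : ∀ {k} (x y z : Vec₂ k) → (λ i → x i xor y i) · z ≡ x · z xor y · z
·-distribʳ-xor x y z = trans (sum-cong-≗ (λ i → ∧-distribʳ-xor (z i) (x i) (y i)))
                             (∑-distrib-+ (λ i → x i ∧ z i) (λ i → y i ∧ z i))

·-scaleˡ : ∀ {k} t (x y : Vec₂ k) → (λ i → t ∧ x i) · y ≡ t ∧ x · y
·-scaleˡ t x y =
  trans (sum-cong-≗ (λ i → ∧-assoc t (x i) (y i))) (sym (*-distribˡ-sum t (λ i → x i ∧ y i)))

δ : ∀ {k} → Fin k → Vec₂ k
δ zero    zero    = true
δ zero    (suc _) = false
δ (suc _) zero    = false
δ (suc i) (suc j) = δ i j

δ-sym : ∀ {k} (i j : Fin k) → δ i j ≡ δ j i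
δ-sym zero    zero    = refl
δ-sym zero    (suc j) = refl
δ-sym (suc i) zero    = refl
δ-sym (suc i) (suc j) = δ-sym i j

δ-diag : ∀ {k} (i : Fin k) → δ i i ≡ true
δ-diag zero    = refl
δ-diag (suc i) = δ-diag i

δ-· : ∀ {k} (i : Fin k) (x : Vec₂ k) → δ i · x ≡ x i
δ-· zero    x =
  trans (cong (x zero xor_) (sum-zero {g = λ l → δ zero (suc l) ∧ x (suc l)} (λ _ → refl)))
        (xor-identityʳ (x zero))
δ-· (suc i) x = δ-· i (x ∘ suc)

column : ∀ {k m} → Mat k m → Fin m → Vec₂ k
column M j i = M i j

combo≡· : ∀ {k m} (c : Vec₂ k) (M : Mat k m) j → combo c M j ≡ c · column M j
combo≡· {zero}  c M j = refl
combo≡· {suc k} c M j = cong (c zero ∧ M zero j xor_) (combo≡· (c ∘ suc) (M ∘ suc) j)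

combo-distribʳ-xor : ∀ {k m} (c d : Vec₂ k) (M : Mat k m) j →
                     combo (λ i → c i xor d i) M j ≡ combo c M j xor combo d M j
combo-distribʳ-xor c d M j = begin
  combo (λ i → c i xor d i) M j     ≡⟨ combo≡· _ M j ⟩
  (λ i → c i xor d i) · column M j  ≡⟨ ·-distribʳ-xor c d (column M j) ⟩
  c · column M j xor d · column M j ≡⟨ sym (cong₂ _xor_ (combo≡· c M j) (combo≡· d M j)) ⟩
  combo c M j xor combo d M j       ∎
  where open ≡-Reasoning

combo-scale : ∀ {k m} t (c : Vec₂ k) (M : Mat k m) j → combo (λ i → t ∧ c i) M j ≡ t ∧ combo c M j
combo-scale t c M j =
  trans (combo≡· _ M j) (trans (·-scaleˡ t c (column M j)) (cong (t ∧_) (sym (combo≡· c M j))))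

combo-· : ∀ {k m} (a : Vec₂ k) (U : Mat k m) (x : Vec₂ m) → combo a U · x ≡ a · (λ l → U l · x)
combo-· a U x = begin
  combo a U · x
    ≡⟨ sum-cong-≗ (λ j → cong (_∧ x j) (combo≡· a U j)) ⟩
  sum (λ j → sum (λ l → a l ∧ U l j) ∧ x j)
    ≡⟨ sum-cong-≗ (λ j → *-distribʳ-sum (x j) (λ l → a l ∧ U l j)) ⟩
  sum (λ j → sum (λ l → (a l ∧ U l j) ∧ x j))
    ≡⟨ ∑-comm (λ j l → (a l ∧ U l j) ∧ x j) ⟩
  sum (λ l → sum (λ j → (a l ∧ U l j) ∧ x j))
    ≡⟨ sum-cong-≗ (λ l → sum-cong-≗ (λ j → ∧-assoc (a l) (U l j) (x j))) ⟩
  sum (λ l → sum (λ j → a l ∧ (U l j ∧ x j)))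
    ≡⟨ sum-cong-≗ (λ l → sym (*-distribˡ-sum (a l) (λ j → U l j ∧ x j))) ⟩
  a · (λ l → U l · x)
    ∎
  where open ≡-Reasoning

combo-remove : ∀ {k m} (q : Fin (suc k)) (c : Vec₂ (suc k)) (M : Mat (suc k) m) j →
               combo c M j ≡ (c q ∧ M q j) xor combo (c ∘ punchIn q) (M ∘ punchIn q) j
combo-remove q c M j =
  trans (combo≡· c M j)
        (trans (sum-remove {i = q} (λ i → c i ∧ M i j))
               (cong (c q ∧ M q j xor_) (sym (combo≡· (c ∘ punchIn q) (M ∘ punchIn q) j))))

span-row : ∀ {a b} (M : Mat a b) i → InRowSpace M (M i)
span-row M i = δ i , λ j → trans (combo≡· (δ i) M j) (δ-· i (column M j))

span-identity : ∀ {m} (x : Vec₂ m) → InRowSpace δ x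
span-identity x = x , λ j →
  trans (combo≡· x δ j)
        (trans (sum-cong-≗ (λ i → cong (x i ∧_) (δ-sym i j))) (trans (·-comm x (δ j)) (δ-· j x)))

span-trans : ∀ {r t b} {g : Mat r b} {h : Mat t b} {x : Vec₂ b} →
             InRowSpace g x → (∀ i → InRowSpace h (g i)) → InRowSpace h x
span-trans {r} {t} {g = g} {h} {x} (c , c-ok) g⊆h = combo c A , λ j → begin
  combo (combo c A) h j            ≡⟨ trans (combo≡· _ h j) (combo-· c A (column h j)) ⟩
  c · (λ i → A i · column h j)     ≡⟨ sum-cong-≗ (λ i → cong (c i ∧_) (A-ok i j)) ⟩
  c · column g j                   ≡⟨ sym (combo≡· c g j) ⟩
  combo c g j                      ≡⟨ c-ok j ⟩
  x j                              ∎
  where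
  open ≡-Reasoning
  A : Mat r t
  A i = proj₁ (g⊆h i)
  A-ok : ∀ i j → A i · column h j ≡ g i j
  A-ok i j = trans (sym (combo≡· (A i) h j)) (proj₂ (g⊆h i) j)

span-sub : ∀ {a b r} {M : Mat a b} {f : Fin r → Fin a} {x : Vec₂ b} →
           InRowSpace (M ∘ f) x → InRowSpace M x
span-sub {M = M} {f} x∈ = span-trans x∈ (λ i → span-row M (f i))

span? : ∀ {r b} (g : Mat r b) (x : Vec₂ b) → Dec (InRowSpace g x)
span? {zero} g x with all? (λ j → false ≟ᵇ x j)
... | yes x≡0 = yes ((λ ()) , x≡0)
... | no x≢0  = no (λ (_ , c-ok) → x≢0 c-ok)
span? {suc r} g x with span? (g ∘ suc) x | span? (g ∘ suc) (λ j → g zero j xor x j)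
... | yes (c , c-ok) | _ = yes (false ∷ c , c-ok)
... | no _ | yes (c , c-ok) =
  yes (true ∷ c , λ j → trans (cong (g zero j xor_) (c-ok j)) (xor-cancelˡ (g zero j) (x j)))
... | no x∉ | no x+g₀∉ = no x∉g
  where
  x∉g : ¬ InRowSpace g x
  x∉g (c , c-ok) with c zero in c₀
  ... | false = x∉ (c ∘ suc , c-ok)
  ... | true  = x+g₀∉ (c ∘ suc , λ j →
                  trans (sym (xor-cancelˡ (g zero j) _)) (cong (g zero j xor_) (c-ok j)))

LinIndep-∷ : ∀ {s b} {u : Mat s b} {x : Vec₂ b} → LinIndep u → ¬ InRowSpace u x → LinIndep (x ∷ u)
LinIndep-∷ {u = u} {x} u-ind x∉u c c-ok with c zero in c₀
... | true  = ⊥-elim (x∉u (c ∘ suc , λ j → sym (xor≡false⇒≡ (x j) _ (c-ok j))))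
... | false = λ where
  zero    → c₀
  (suc i) → u-ind (c ∘ suc) c-ok i

LinIndep-injective : ∀ {s b} {u : Mat s b} → LinIndep u →
                     ∀ c d → (∀ j → combo c u j ≡ combo d u j) → ∀ i → c i ≡ d i
LinIndep-injective {u = u} u-ind c d c≡d i =
  xor≡false⇒≡ (c i) (d i) (u-ind (λ i → c i xor d i) difference i)
  where
  difference : ∀ j → combo (λ i → c i xor d i) u j ≡ false
  difference j = trans (combo-distribʳ-xor c d u j)
                       (trans (cong (_xor combo d u j) (c≡d j)) (xor-same (combo d u j)))

LinIndep-nonzero : ∀ {s b} {u : Mat s b} → LinIndep u → ∀ i → ¬ (∀ j → u i j ≡ false)
LinIndep-nonzero {u = u} u-ind i uᵢ≡0 = not-¬ (δ-diag i) (u-ind (δ i) δᵢ-combo i)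
  where
  δᵢ-combo : ∀ j → combo (δ i) u j ≡ false
  δᵢ-combo j = trans (combo≡· (δ i) u j) (trans (δ-· i (column u j)) (uᵢ≡0 j))

span-drop : ∀ {r b} {g : Mat (suc r) b} {x : Vec₂ b} (q : Fin (suc r)) (c : Vec₂ (suc r)) →
            c q ≡ false → (∀ j → combo c g j ≡ x j) → InRowSpace (g ∘ punchIn q) x
span-drop {g = g} q c c-q c-ok = c ∘ punchIn q , λ j →
  trans (cong (λ t → t ∧ g q j xor combo (c ∘ punchIn q) (g ∘ punchIn q) j) (sym c-q))
        (trans (sym (combo-remove q c g j)) (c-ok j))

span-eliminate : ∀ {r b} {g : Mat (suc r) b} {x y : Vec₂ b} (q : Fin (suc r)) →
                 ((a , _) : InRowSpace g x) → a q ≡ true → ((b , _) : InRowSpace g y) →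
                 InRowSpace (g ∘ punchIn q) (λ j → y j xor (b q ∧ x j))
span-eliminate {r} {g = g} {x} {y} q (a , a-ok) a-q (b , b-ok) = span-drop {g = g} q b′ b′-q b′-ok
  where
  b′ : Vec₂ (suc r)
  b′ l = b l xor (b q ∧ a l)
  b′-q : b′ q ≡ false
  b′-q = trans (cong (λ t → b q xor (b q ∧ t)) a-q)
               (trans (cong (b q xor_) (∧-identityʳ (b q))) (xor-same (b q)))
  b′-ok : ∀ j → combo b′ g j ≡ y j xor (b q ∧ x j)
  b′-ok j = trans (combo-distribʳ-xor b (λ l → b q ∧ a l) g j)
                  (cong₂ _xor_ (b-ok j) (trans (combo-scale (b q) a g j) (cong (b q ∧_) (a-ok j))))

LinIndep-eliminate : ∀ {s b} {u : Mat (suc s) b} → LinIndep u →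
                     ∀ (t : Vec₂ s) → LinIndep (λ i j → u (suc i) j xor (t i ∧ u zero j))
LinIndep-eliminate {u = u} u-ind t c c-ok i = u-ind (c · t ∷ c) lifted (suc i)
  where
  open ≡-Reasoning
  lifted : ∀ j → combo (c · t ∷ c) u j ≡ false
  lifted j = begin
    (c · t ∧ u zero j) xor combo c (u ∘ suc) j
      ≡⟨ xor-comm (c · t ∧ u zero j) (combo c (u ∘ suc) j) ⟩
    combo c (u ∘ suc) j xor (c · t ∧ u zero j)
      ≡⟨ cong₂ _xor_ (combo≡· c (u ∘ suc) j) (*-distribʳ-sum (u zero j) (λ i → c i ∧ t i)) ⟩
    sum (λ i → c i ∧ u (suc i) j) xor sum (λ i → (c i ∧ t i) ∧ u zero j)
      ≡⟨ sym (∑-distrib-+ (λ i → c i ∧ u (suc i) j) (λ i → (c i ∧ t i) ∧ u zero j)) ⟩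
    sum (λ i → (c i ∧ u (suc i) j) xor ((c i ∧ t i) ∧ u zero j))
      ≡⟨ sum-cong-≗ (λ i → cong (c i ∧ u (suc i) j xor_) (∧-assoc (c i) (t i) (u zero j))) ⟩
    sum (λ i → (c i ∧ u (suc i) j) xor (c i ∧ (t i ∧ u zero j)))
      ≡⟨ sum-cong-≗ (λ i → sym (∧-distribˡ-xor (c i) (u (suc i) j) (t i ∧ u zero j))) ⟩
    sum (λ i → c i ∧ (u (suc i) j xor (t i ∧ u zero j)))
      ≡⟨ sym (combo≡· c _ j) ⟩
    combo c (λ i j → u (suc i) j xor (t i ∧ u zero j)) j
      ≡⟨ c-ok j ⟩
    false ∎

nonzero-coefficient : ∀ {s r b} {u : Mat (suc s) b} {g : Mat r b} → LinIndep u →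
                      ((a , _) : InRowSpace g (u zero)) → ∃ λ q → a q ≡ true
nonzero-coefficient {u = u} {g} u-ind (a , a-ok) with any? (λ q → a q ≟ᵇ true)
... | yes found = found
... | no none   = ⊥-elim (LinIndep-nonzero {u = u} u-ind zero λ j →
        trans (sym (a-ok j)) (trans (combo≡· a g j) (sum-zero (λ q → cong (_∧ g q j) (a≡0 q)))))
  where
  a≡0 : ∀ q → a q ≡ false
  a≡0 q = ¬-not (λ aq → none (q , aq))

-- Eliminating the pivot coordinate q of u₀ from the other vectors keeps them independent
-- and puts them in the span of the rows of g other than g_q.
steinitz : ∀ {s r b} (u : Mat s b) (g : Mat r b) → LinIndep u → (∀ i → InRowSpace g (u i)) → s ≤ r
steinitz {zero} _ _ _ _ = z≤n
steinitz {suc s} {zero} u g u-ind u⊆g with nonzero-coefficient {u = u} {g} u-ind (u⊆g zero)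
... | () , _
steinitz {suc s} {suc r} u g u-ind u⊆g with nonzero-coefficient {u = u} {g} u-ind (u⊆g zero)
... | q , a-q = s≤s (steinitz _ (g ∘ punchIn q) (LinIndep-eliminate {u = u} u-ind t) reduced⊆)
  where
  t : Vec₂ s
  t i = proj₁ (u⊆g (suc i)) q
  reduced⊆ : ∀ i → InRowSpace (g ∘ punchIn q) (λ j → u (suc i) j xor (t i ∧ u zero j))
  reduced⊆ i = span-eliminate {g = g} q (u⊆g zero) a-q (u⊆g (suc i))

¬LinIndep-beyond-span : ∀ {a b r} {M : Mat a b} (g : Mat r b) → (∀ i → InRowSpace g (M i)) →
                        ∀ (f : Fin (suc r) → Fin a) → ¬ LinIndep (M ∘ f)
¬LinIndep-beyond-span {M = M} g M⊆g f ind = 1+n≰n (steinitz (M ∘ f) g ind (M⊆g ∘ f))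

orthogonal-to-spanning : ∀ {s m} {U : Mat s m} → (∀ x → InRowSpace U x) →
                         ∀ d → (∀ l → U l · d ≡ false) → ∀ i → d i ≡ false
orthogonal-to-spanning {s} {U = U} U-spans d U⊥d i = begin
  d i                  ≡⟨ sym (δ-· i d) ⟩
  δ i · d              ≡⟨ sum-cong-≗ (λ j → cong (_∧ d j) (sym (a-ok j))) ⟩
  combo a U · d        ≡⟨ combo-· a U d ⟩
  a · (λ l → U l · d)  ≡⟨ sum-zero (λ l → trans (cong (a l ∧_) (U⊥d l)) (∧-zeroʳ (a l))) ⟩
  false                ∎
  where
  open ≡-Reasoning
  a : Vec₂ s
  a = proj₁ (U-spans (δ i))
  a-ok : ∀ j → combo a U j ≡ δ i j
  a-ok = proj₂ (U-spans (δ i))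

span-complete : ∀ {m} {u : Mat m m} → LinIndep u → ∀ x → InRowSpace u x
span-complete {u = u} u-ind x with span? u x
... | yes x∈u = x∈u
... | no x∉u  =
  ⊥-elim (¬LinIndep-beyond-span {M = x ∷ u} δ (span-identity ∘ (x ∷ u)) id (LinIndep-∷ u-ind x∉u))

record RowBasis {a b r} (M : Mat a b) (f : Fin r → Fin a) : Set where
  field
    independent : LinIndep (M ∘ f)
    spans       : ∀ i → InRowSpace (M ∘ f) (M i)
open RowBasis

RowBasis⇒HasRank : ∀ {a b r} {M : Mat a b} {f : Fin r → Fin a} → RowBasis M f → HasRank M r
RowBasis⇒HasRank {f = f} basis = (f , independent basis) , ¬LinIndep-beyond-span _ (spans basis)

LinIndep⇒HasRank : ∀ {a b} {M : Mat a b} → LinIndep M → HasRank M a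
LinIndep⇒HasRank {M = M} ind =
  RowBasis⇒HasRank {f = id} record { independent = ind ; spans = span-row M }

HasRank⇒RowBasis : ∀ {a b r} {M : Mat a b} → HasRank M r → ∃ (RowBasis M)
HasRank⇒RowBasis {M = M} ((f , ind) , maximal) = f , record { independent = ind ; spans = M⊆ }
  where
  M⊆ : ∀ i → InRowSpace (M ∘ f) (M i)
  M⊆ i with span? (M ∘ f) (M i)
  ... | yes Mᵢ∈ = Mᵢ∈
  ... | no Mᵢ∉  = ⊥-elim (maximal (i ∷ f) (LinIndep-∷ ind Mᵢ∉))

HasRank-full⇒span : ∀ {a m} {M : Mat a m} → HasRank M m → ∀ x → InRowSpace M x
HasRank-full⇒span {M = M} M-rank x with HasRank⇒RowBasis {M = M} M-rank
... | f , basis = span-sub {M = M} {f = f} (span-complete {u = M ∘ f} (independent basis) x)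

IsSymmetric : ∀ {m} → Mat m m → Set
IsSymmetric N = ∀ i j → N i j ≡ N j i

tridiagonal-symmetric : ∀ {m} {N : Mat m m} → IsTridiagOnes N → IsSymmetric N
tridiagonal-symmetric (adjacent , far) i j with i ≟ᶠ j
... | yes refl = refl
... | no i≢j with (toℕ j ≟ⁿ suc (toℕ i)) ⊎-dec (toℕ i ≟ⁿ suc (toℕ j))
...   | yes i~j = trans (adjacent i j i~j) (sym (adjacent j i (swap i~j)))
...   | no i≁j  = trans (far i j i≢j i≁j) (sym (far j i (i≢j ∘ sym) (i≁j ∘ swap)))

·-combo-symmetric : ∀ {m r} {N : Mat m m} → IsSymmetric N → (f : Fin r → Fin m) (u w : Vec₂ r) →
                    u · (combo w (N ∘ f) ∘ f) ≡ w · (combo u (N ∘ f) ∘ f)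
·-combo-symmetric {r = r} {N} N-sym f u w = begin
  u · (combo w (N ∘ f) ∘ f)          ≡⟨ sum-cong-≗ (λ l → cong (u l ∧_) (combo-row l)) ⟩
  u · (λ l → Nᵀ l · w)               ≡⟨ sym (combo-· u Nᵀ w) ⟩
  combo u Nᵀ · w                     ≡⟨ sum-cong-≗ (λ p → cong (_∧ w p) (combo-transpose p)) ⟩
  (combo u (N ∘ f) ∘ f) · w          ≡⟨ ·-comm (combo u (N ∘ f) ∘ f) w ⟩
  w · (combo u (N ∘ f) ∘ f)          ∎
  where
  open ≡-Reasoning
  Nᵀ : Mat r r
  Nᵀ l p = N (f p) (f l)
  combo-row : ∀ l → combo w (N ∘ f) (f l) ≡ Nᵀ l · w
  combo-row l = trans (combo≡· w (N ∘ f) (f l)) (·-comm w (Nᵀ l))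
  combo-transpose : ∀ p → combo u Nᵀ p ≡ combo u (N ∘ f) (f p)
  combo-transpose p = trans (combo≡· u Nᵀ p)
    (trans (sum-cong-≗ (λ l → cong (u l ∧_) (N-sym (f p) (f l)))) (sym (combo≡· u (N ∘ f) (f p))))

combo-lower-border : ∀ {m r} {N : Mat m m} {v : Vec₂ m} c (g : Fin r → Fin m) d →
                     combo d (bordered c v N ∘ suc ∘ g) zero ≡ d · (v ∘ g)
combo-lower-border c g d = combo≡· d _ zero

combo-lower-block : ∀ {m r} {N : Mat m m} {v : Vec₂ m} c (g : Fin r → Fin m) d j →
                    combo d (bordered c v N ∘ suc ∘ g) (suc j) ≡ combo d (N ∘ g) j
combo-lower-block {N = N} c g d j = trans (combo≡· d _ (suc j)) (sym (combo≡· d (N ∘ g) j))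

module BorderedBasis {m} {N : Mat m m} (N-sym : IsSymmetric N) (v : Vec₂ m)
                    {r} {f : Fin r → Fin m} (basis : RowBasis N f) (v∈ : InRowSpace (N ∘ f) v) where

  private
    w : Vec₂ r
    w = proj₁ v∈
    w-ok : ∀ j → combo w (N ∘ f) j ≡ v j
    w-ok = proj₂ v∈

  corner : Bool
  corner = w · (v ∘ f)

  module _ (c : Bool) where
    private
      B = bordered c v N

    lower-independent : LinIndep (B ∘ suc ∘ f)
    lower-independent d d-ok =
      independent basis d (λ j → trans (sym (combo-lower-block c f d j)) (d-ok (suc j)))

    lower-spans : ∀ a → InRowSpace (B ∘ suc ∘ f) (B (suc a))
    lower-spans a with spans basis a
    ... | u , u-ok = u , λ where
        zero    → begin
          combo u (B ∘ suc ∘ f) zero  ≡⟨ combo-lower-border c f u ⟩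
          u · (v ∘ f)                 ≡⟨ sum-cong-≗ (λ l → cong (u l ∧_) (sym (w-ok (f l)))) ⟩
          u · (combo w (N ∘ f) ∘ f)   ≡⟨ ·-combo-symmetric N-sym f u w ⟩
          w · (combo u (N ∘ f) ∘ f)   ≡⟨ sum-cong-≗ (λ p → cong (w p ∧_) (u-ok (f p))) ⟩
          w · (N a ∘ f)               ≡⟨ sum-cong-≗ (λ p → cong (w p ∧_) (N-sym a (f p))) ⟩
          w · column (N ∘ f) a        ≡⟨ sym (combo≡· w (N ∘ f) a) ⟩
          combo w (N ∘ f) a           ≡⟨ w-ok a ⟩
          v a                         ∎
        (suc j) → trans (combo-lower-block c f u j) (u-ok j)
      where open ≡-Reasoning

    top-combo : ∀ j → combo w (B ∘ suc ∘ f) j ≡ (corner ∷ v) j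
    top-combo zero    = combo-lower-border c f w
    top-combo (suc j) = trans (combo-lower-block c f w j) (w-ok j)

    basis-at-corner : c ≡ corner → RowBasis B (suc ∘ f)
    basis-at-corner c≡corner = record { independent = lower-independent ; spans = B⊆ }
      where
      B⊆ : ∀ i → InRowSpace (B ∘ suc ∘ f) (B i)
      B⊆ zero    = w , λ where
        zero    → trans (top-combo zero) (sym c≡corner)
        (suc j) → top-combo (suc j)
      B⊆ (suc a) = lower-spans a

    top-∉ : c ≡ not corner → ¬ InRowSpace (B ∘ suc ∘ f) (B zero)
    top-∉ c≡¬corner (d , d-ok) = not-¬ refl (trans corner≡c c≡¬corner)
      where
      d≡w : ∀ l → d l ≡ w l
      d≡w = LinIndep-injective (independent basis) d w
              (λ j → trans (sym (combo-lower-block c f d j)) (trans (d-ok (suc j)) (sym (w-ok j))))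
      corner≡c : corner ≡ c
      corner≡c = trans (sum-cong-≗ (λ l → cong (_∧ v (f l)) (sym (d≡w l))))
                       (trans (sym (combo-lower-border c f d)) (d-ok zero))

    basis-off-corner : c ≡ not corner → RowBasis B (zero ∷ suc ∘ f)
    basis-off-corner c≡¬corner = record
      { independent = LinIndep-∷ lower-independent (top-∉ c≡¬corner)
      ; spans       = λ where
          zero    → span-row (B ∘ (zero ∷ suc ∘ f)) zero
          (suc a) → span-sub {M = B ∘ (zero ∷ suc ∘ f)} {f = suc} (lower-spans a)
      }

BorderedRanks : ∀ {m} → Mat m m → Vec₂ m → ℕ → Set
BorderedRanks N v r = (HasRank (bordered false v N) r × HasRank (bordered true v N) (suc r))
                    ⊎ (HasRank (bordered false v N) (suc r) × HasRank (bordered true v N) r)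

bordered-ranks : ∀ {m r} {N : Mat m m} {v : Vec₂ m} → IsSymmetric N →
                 HasRank N r → InRowSpace N v → BorderedRanks N v r
bordered-ranks {r = r} {N} {v} N-sym N-rank v∈N with HasRank⇒RowBasis {M = N} N-rank
... | f , basis = ranks
  where
  open BorderedBasis N-sym v basis (span-trans v∈N (spans basis))
  ranks : BorderedRanks N v r
  ranks with corner in corner≡
  ... | false = inj₁ ( RowBasis⇒HasRank (basis-at-corner false (sym corner≡))
                     , RowBasis⇒HasRank (basis-off-corner true (cong not (sym corner≡))))
  ... | true  = inj₂ ( RowBasis⇒HasRank (basis-off-corner false (cong not (sym corner≡)))
                     , RowBasis⇒HasRank (basis-at-corner true (sym corner≡)))

bordered-independent : ∀ {k} {N : Mat (suc k) (suc k)} {v : Vec₂ (suc k)} → IsSymmetric N →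
                       HasRank N k → ¬ InRowSpace N v → ∀ c → LinIndep (bordered c v N)
bordered-independent {N = N} {v} N-sym ((f , f-ind) , _) v∉N c d d-ok with d zero in d₀
... | true  = ⊥-elim (v∉N (d ∘ suc , λ j → sym (xor≡false⇒≡ (v j) _
                (trans (cong (v j xor_) (sym (combo-lower-block c id (d ∘ suc) j))) (d-ok (suc j))))))
... | false = d≡0
  where
  U : Mat _ _
  U = v ∷ N ∘ f
  U-ind : LinIndep U
  U-ind = LinIndep-∷ f-ind (v∉N ∘ span-sub {M = N} {f = f})
  U⊥d : ∀ l → U l · (d ∘ suc) ≡ false
  U⊥d zero    = trans (·-comm v (d ∘ suc))
                      (trans (sym (combo-lower-border c id (d ∘ suc))) (d-ok zero))
  U⊥d (suc l) = begin
    N (f l) · (d ∘ suc)                                  ≡⟨ sum-cong-≗ (λ j → cong (_∧ d (suc j)) (N-sym (f l) j)) ⟩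
    column N (f l) · (d ∘ suc)                           ≡⟨ ·-comm (column N (f l)) (d ∘ suc) ⟩
    (d ∘ suc) · column N (f l)                           ≡⟨ sym (combo≡· (d ∘ suc) N (f l)) ⟩
    combo (d ∘ suc) N (f l)                              ≡⟨ sym (combo-lower-block c id (d ∘ suc) (f l)) ⟩
    combo (d ∘ suc) (bordered c v N ∘ suc) (suc (f l))   ≡⟨ d-ok (suc (f l)) ⟩
    false                                                ∎
    where open ≡-Reasoning
  d≡0 : ∀ i → d i ≡ false
  d≡0 zero    = d₀
  d≡0 (suc i) = orthogonal-to-spanning {U = U} (span-complete {u = U} U-ind) (d ∘ suc) U⊥d i

mainTheorem6 : (k : ℕ) (adj : Fin (suc (suc k)) → Fin (suc (suc k)) → Bool)
    → IsSimpleGraph adj → Connected adj → InducedPath adj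
    → (N : Mat (suc k) (suc k)) → IsTridiagOnes N
    → let v = λ (i : Fin (suc k)) → adj zero (suc i)
          N0 = bordered false v N
          N1 = bordered true v N
      in (HasRank N (suc k)
            → (HasRank N0 (suc k) × HasRank N1 (suc (suc k)))
              ⊎ (HasRank N0 (suc (suc k)) × HasRank N1 (suc k)))
         × (HasRank N k → ¬ InRowSpace N v
            → HasRank N0 (suc (suc k)) × HasRank N1 (suc (suc k)))
         × (HasRank N k → InRowSpace N v
            → (HasRank N0 k × HasRank N1 (suc k))
              ⊎ (HasRank N0 (suc k) × HasRank N1 k))
mainTheorem6 k adj _ _ _ N tridiagonal =
    (λ N-rank → bordered-ranks N-sym N-rank (HasRank-full⇒span {M = N} N-rank v))
  , (λ N-rank v∉N → bordered-full-rank false N-rank v∉N , bordered-full-rank true N-rank v∉N)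
  , bordered-ranks N-sym
  where
  v : Vec₂ (suc k)
  v i = adj zero (suc i)
  N-sym : IsSymmetric N
  N-sym = tridiagonal-symmetric tridiagonal
  bordered-full-rank : ∀ c → HasRank N k → ¬ InRowSpace N v → HasRank (bordered c v N) (suc (suc k))
  bordered-full-rank c N-rank v∉N =
    LinIndep⇒HasRank {M = bordered c v N} (bordered-independent N-sym N-rank v∉N c)
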